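{- For any partition $\lambda$ and part $i$ of $\lambda$, $\psi(e_{\lambda,i})=i\,e_\lambda$.
   Context: $\Lambda$ is the ring of symmetric functions, $p_\lambda$ power sums, $e_k$ elementary symmetric functions ($e_0=1$), $e_\mu=\prod_je_{\mu_j}$. $\psi:\Lambda[t]\to\Lambda$ is the linear map with $\psi(p_\mu t^{k-1})=p_{\mu\cup k}$ for $k\ge1$, $\mu\cup k$ being $\mu$ with a part $k$ added. Pointed elementary symmetric functions: $e_{i,i}=\sum_{k=1}^i(-t)^{k-1}e_{i-k}$ (equal to the pointed Schur function $s_{(1^i),1}$) and $e_{\lambda,i}=e_{i,i}\prod_{j\in\lambda\setminus i}e_j$, where $\lambda\setminus i$ removes one copy of $i$ from $\lambda$. -}

module Defs where

-- Model: Λ ⊗ ℚ is the polynomial algebra ℚ[p₁,p₂,…] (power sums are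
-- algebraically independent), so an element is a finite ℚ-linear
-- combination of power-sum monomials p_μ, μ a partition.  Elements are
-- represented by lists of terms; equality is coefficientwise (setoid).

open import Data.Nat as ℕ using (ℕ; zero; suc; _≤?_)
open import Data.Integer as ℤ using (+_)
open import Data.Rational as ℚ using (ℚ; 0ℚ; 1ℚ; _/_)
open import Data.List using (List; []; _∷_; _++_; map; concatMap; foldr; zip; upTo)
open import Data.List.Properties using (≡-dec)
open import Data.Product using (_×_; _,_)
open import Relation.Nullary using (yes; no)
open import Relation.Binary.PropositionalEquality using (_≡_)

-- Partitions as weakly increasing lists of positive parts (canonical form).
Partition : Set
Partition = List ℕ

insertPart : ℕ → Partition → Partition
insertPart k [] = k ∷ []
insertPart k (m ∷ μ) with k ≤? m
... | yes _ = k ∷ m ∷ μ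
... | no  _ = m ∷ insertPart k μ

_∪_ : Partition → Partition → Partition
μ ∪ ν = foldr insertPart ν μ

Λ : Set
Λ = List (ℚ × Partition)

-- p_μ (μ given in canonical form)
pw : Partition → Λ
pw μ = (1ℚ , μ) ∷ []

p : ℕ → Λ
p k = pw (k ∷ [])

oneΛ : Λ
oneΛ = pw []

_+Λ_ : Λ → Λ → Λ
f +Λ g = f ++ g

_·Λ_ : ℚ → Λ → Λ
c ·Λ f = map (λ { (d , μ) → (c ℚ.* d , μ) }) f

_*Λ_ : Λ → Λ → Λ
f *Λ g = concatMap (λ { (c , μ) → map (λ { (d , ν) → (c ℚ.* d , μ ∪ ν) }) g }) f

sumΛ : List Λ → Λ
sumΛ = foldr _+Λ_ []

prodΛ : List Λ → Λ
prodΛ = foldr _*Λ_ oneΛ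

coeff : Λ → Partition → ℚ
coeff [] μ = 0ℚ
coeff ((c , ν) ∷ f) μ with ≡-dec ℕ._≟_ ν μ
... | yes _ = c ℚ.+ coeff f μ
... | no  _ = coeff f μ

infix 4 _≈Λ_
_≈Λ_ : Λ → Λ → Set
f ≈Λ g = ∀ μ → coeff f μ ≡ coeff g μ

sgn : ℕ → ℚ
sgn zero = 1ℚ
sgn (suc n) = ℚ.- sgn n

-- Elementary symmetric functions via Newton's identities:
--   e₀ = 1,  k e_k = Σ_{i=1}^{k} (-1)^{i-1} p_i e_{k-i}.
-- eDown k = [e_k, e_{k-1}, …, e_0].

eDown : ℕ → List Λ
eDown zero = oneΛ ∷ []
eDown (suc k) = eNew ∷ eDown k
  where
  -- zip i-1 ∈ [0..k] with e_k, …, e_0, i.e. i = 1..k+1 with e_{k+1-i}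
  terms : List Λ
  terms = map (λ { (j , ej) → sgn j ·Λ (p (suc j) *Λ ej) }) (zip (upTo (suc k)) (eDown k))
  eNew : Λ
  eNew = (+ 1 / suc k) ·Λ sumΛ terms

headOr : List Λ → Λ
headOr [] = []
headOr (x ∷ _) = x

e : ℕ → Λ
e k = headOr (eDown k)

eP : List ℕ → Λ
eP μ = prodΛ (map e μ)

-- Λ[t]: terms c · t^n · p_μ

Λt : Set
Λt = List (ℚ × ℕ × Partition)

_*t_ : Λt → Λ → Λt
F *t g = concatMap (λ { (c , n , μ) → map (λ { (d , ν) → (c ℚ.* d , n , μ ∪ ν) }) g }) F

-- ψ(p_μ t^{k-1}) = p_{μ ∪ k}, extended linearly
ψ : Λt → Λ
ψ = map (λ { (c , n , μ) → (c , insertPart (suc n) μ) })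

-- (-t)^n · f
tpow : ℕ → Λ → Λt
tpow n f = map (λ { (c , μ) → (sgn n ℚ.* c , n , μ) }) f

-- pointed elementary e_{i,i} = Σ_{k=1}^{i} (-t)^{k-1} e_{i-k}
-- (sum over m = k-1 ∈ [0, i-1], term (-t)^m e_{i-1-m})
eii : ℕ → Λt
eii i = concatMap (λ m → tpow m (e (i ℕ.∸ suc m))) (upTo i)

{-# OPTIONS --safe #-}
-- Since ψ(p_μ t^m) = p_{m+1} p_μ, multiplying (-t)^m f by g and applying ψ gives
-- (-1)^m p_{m+1} f g.  Hence ψ(e_{i,i} e_{λ∖i}) = (Σ_{m<i} (-1)^m p_{m+1} e_{i-1-m}) e_{λ∖i},
-- and by Newton's identity (the recursion defining e) the bracket is i e_i.  Finally
-- e_i e_{λ∖i} = e_λ because the product of Λ is commutative; on the list representation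
-- this holds up to a permutation of terms, which leaves every coefficient unchanged.
module Submission where

open import Defs
open import Algebra.Bundles using (CommutativeMonoid)
import Algebra.Properties.CommutativeSemigroup as CommutativeSemigroupProperties
open import Data.Integer using (+_)
open import Data.List using (List; []; _∷_; _++_; map; concat; concatMap; foldr; zip; upTo; applyUpTo)
open import Data.List.Membership.Propositional using (_∈_)
open import Data.List.Properties
  using (map-id; map-∘; map-cong; map-++; map-applyUpTo; map-concatMap; concatMap-cong; concatMap-++; ≡-dec)
open import Data.List.Relation.Binary.Permutation.Propositional
  using (_↭_; ↭-refl; ↭-reflexive; ↭-trans; ↭-sym; ↭⇒↭ₛ; module PermutationReasoning)
open import Data.List.Relation.Binary.Permutation.Propositional.Properties
  using (++⁺; ++⁺ˡ; map⁺; ++-commutativeMonoid)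
open import Data.List.Relation.Unary.All using (All; lookup)
open import Data.List.Relation.Unary.Any using (here; there; _─_)
open import Data.Nat as ℕ using (ℕ; zero; suc; _∸_; _≤_; _≰_; _<_; _≤?_)
open import Data.Nat.Coprimality as Coprimality using (Coprime; 1-coprimeTo)
open import Data.Nat.Properties using (<-cmp; <⇒≤; <⇒≱; ≤-trans)
open import Data.Product using (_×_; _,_; proj₁; proj₂)
open import Data.Rational as ℚ using (ℚ; 0ℚ; 1ℚ; mkℚ; _/_)
import Data.Rational.Properties as ℚ
open import Function using (id; _∘_)
open import Relation.Binary.Definitions using (tri<; tri≈; tri>)
import Relation.Binary.PropositionalEquality as ≡
open import Relation.Binary.PropositionalEquality using (_≡_; refl; sym; trans; cong; cong₂; module ≡-Reasoning)
open import Relation.Nullary using (yes; no; contradiction)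

open import Data.List.Relation.Binary.Permutation.Setoid.Properties (≡.setoid ℚ) using (foldr-commMonoid)
open CommutativeSemigroupProperties (CommutativeMonoid.commutativeSemigroup ℚ.*-1-commutativeMonoid)
  using () renaming (x∙yz≈y∙xz to *-lcomm)

insertPart-≤ : ∀ {a m} μ → a ≤ m → insertPart a (m ∷ μ) ≡ a ∷ m ∷ μ
insertPart-≤ {a} {m} μ a≤m with a ≤? m
... | yes _  = refl
... | no a≰m = contradiction a≤m a≰m

insertPart-≰ : ∀ {a m} μ → a ≰ m → insertPart a (m ∷ μ) ≡ m ∷ insertPart a μ
insertPart-≰ {a} {m} μ a≰m with a ≤? m
... | yes a≤m = contradiction a≤m a≰m
... | no _    = refl

insertPart-comm-< : ∀ {a b} → a < b → ∀ μ →
                    insertPart a (insertPart b μ) ≡ insertPart b (insertPart a μ)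
insertPart-comm-< a<b [] = trans (insertPart-≤ [] (<⇒≤ a<b)) (sym (insertPart-≰ [] (<⇒≱ a<b)))
insertPart-comm-< {a} {b} a<b (m ∷ μ) with b ≤? m | a ≤? m
... | yes b≤m | yes a≤m = begin
  insertPart a (b ∷ m ∷ μ)  ≡⟨ insertPart-≤ (m ∷ μ) (<⇒≤ a<b) ⟩
  a ∷ b ∷ m ∷ μ             ≡⟨ cong (a ∷_) (insertPart-≤ μ b≤m) ⟨
  a ∷ insertPart b (m ∷ μ)  ≡⟨ insertPart-≰ (m ∷ μ) (<⇒≱ a<b) ⟨
  insertPart b (a ∷ m ∷ μ)  ∎
  where open ≡-Reasoning
... | yes b≤m | no a≰m  = contradiction (≤-trans (<⇒≤ a<b) b≤m) a≰m
... | no b≰m  | yes a≤m = begin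
  insertPart a (m ∷ insertPart b μ)  ≡⟨ insertPart-≤ (insertPart b μ) a≤m ⟩
  a ∷ m ∷ insertPart b μ             ≡⟨ cong (a ∷_) (insertPart-≰ μ b≰m) ⟨
  a ∷ insertPart b (m ∷ μ)           ≡⟨ insertPart-≰ (m ∷ μ) (<⇒≱ a<b) ⟨
  insertPart b (a ∷ m ∷ μ)           ∎
  where open ≡-Reasoning
... | no b≰m  | no a≰m  = begin
  insertPart a (m ∷ insertPart b μ)  ≡⟨ insertPart-≰ (insertPart b μ) a≰m ⟩
  m ∷ insertPart a (insertPart b μ)  ≡⟨ cong (m ∷_) (insertPart-comm-< a<b μ) ⟩
  m ∷ insertPart b (insertPart a μ)  ≡⟨ insertPart-≰ (insertPart a μ) b≰m ⟨
  insertPart b (m ∷ insertPart a μ)  ∎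
  where open ≡-Reasoning

insertPart-comm : ∀ a b μ → insertPart a (insertPart b μ) ≡ insertPart b (insertPart a μ)
insertPart-comm a b μ with <-cmp a b
... | tri< a<b _ _  = insertPart-comm-< a<b μ
... | tri≈ _ refl _ = refl
... | tri> _ _ b<a  = sym (insertPart-comm-< b<a μ)

insertPart-∪ : ∀ k μ ν → insertPart k μ ∪ ν ≡ insertPart k (μ ∪ ν)
insertPart-∪ k []      ν = refl
insertPart-∪ k (m ∷ μ) ν with k ≤? m
... | yes _ = refl
... | no _  = trans (cong (insertPart m) (insertPart-∪ k μ ν)) (insertPart-comm m k (μ ∪ ν))

∪-insertPart : ∀ k μ ν → μ ∪ insertPart k ν ≡ insertPart k (μ ∪ ν)
∪-insertPart k []      ν = refl
∪-insertPart k (m ∷ μ) ν = trans (cong (insertPart m) (∪-insertPart k μ ν)) (insertPart-comm m k (μ ∪ ν))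

∪-lcomm : ∀ α β γ → α ∪ (β ∪ γ) ≡ β ∪ (α ∪ γ)
∪-lcomm α []      γ = refl
∪-lcomm α (b ∷ β) γ = trans (∪-insertPart b α (β ∪ γ)) (cong (insertPart b) (∪-lcomm α β γ))

concatMap-pointwise-++ : ∀ {A B : Set} (F G : A → List B) xs →
                         concatMap (λ x → F x ++ G x) xs ↭ concatMap F xs ++ concatMap G xs
concatMap-pointwise-++ F G []       = ↭-refl
concatMap-pointwise-++ F G (x ∷ xs) =
  ↭-trans (++⁺ˡ (F x ++ G x) (concatMap-pointwise-++ F G xs))
          (interchange (F x) (G x) (concatMap F xs) (concatMap G xs))
  where open CommutativeSemigroupProperties (CommutativeMonoid.commutativeSemigroup ++-commutativeMonoid)

concatMap-comm : ∀ {A B C : Set} (T : A → B → List C) xs ys →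
                 concatMap (λ x → concatMap (T x) ys) xs ↭ concatMap (λ y → concatMap (λ x → T x y) xs) ys
concatMap-comm T []       ys = ↭-reflexive (sym (concatMap-[] ys))
  where
  concatMap-[] : ∀ ys → concatMap (λ _ → []) ys ≡ []
  concatMap-[] []       = refl
  concatMap-[] (_ ∷ ys) = concatMap-[] ys
concatMap-comm T (x ∷ xs) ys =
  ↭-trans (++⁺ˡ (concatMap (T x) ys) (concatMap-comm T xs ys))
          (↭-sym (concatMap-pointwise-++ (T x) (λ y → concatMap (λ x → T x y) xs) ys))

zip-applyUpTo : ∀ {A B : Set} (f : ℕ → A) (g : ℕ → B) n →
                zip (applyUpTo f n) (applyUpTo g n) ≡ applyUpTo (λ j → f j , g j) n
zip-applyUpTo f g zero    = refl
zip-applyUpTo f g (suc n) = cong ((f 0 , g 0) ∷_) (zip-applyUpTo (f ∘ suc) (g ∘ suc) n)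

Term : Set
Term = ℚ × Partition

_⊗_ : Term → Term → Term
(c , μ) ⊗ (d , ν) = (c ℚ.* d , μ ∪ ν)

⊗-lcomm : ∀ x y z → x ⊗ (y ⊗ z) ≡ y ⊗ (x ⊗ z)
⊗-lcomm (a , α) (b , β) (c , γ) = cong₂ _,_ (*-lcomm a b c) (∪-lcomm α β γ)

*Λ-*Λ-expand : ∀ f g h → f *Λ (g *Λ h) ≡ concatMap (λ x → concatMap (λ y → map (λ z → x ⊗ (y ⊗ z)) h) g) f
*Λ-*Λ-expand f g h = concatMap-cong (λ x →
  trans (map-concatMap (x ⊗_) _ g) (concatMap-cong (λ y → sym (map-∘ h)) g)) f

*Λ-lcomm : ∀ f g h → f *Λ (g *Λ h) ↭ g *Λ (f *Λ h)
*Λ-lcomm f g h = begin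
  f *Λ (g *Λ h)                                                       ≡⟨ *Λ-*Λ-expand f g h ⟩
  concatMap (λ x → concatMap (λ y → map (λ z → x ⊗ (y ⊗ z)) h) g) f  ↭⟨ concatMap-comm _ f g ⟩
  concatMap (λ y → concatMap (λ x → map (λ z → x ⊗ (y ⊗ z)) h) f) g  ≡⟨ concatMap-cong (λ y → concatMap-cong (λ x → map-cong (⊗-lcomm x y) h) f) g ⟩
  concatMap (λ y → concatMap (λ x → map (λ z → y ⊗ (x ⊗ z)) h) f) g  ≡⟨ *Λ-*Λ-expand g f h ⟨
  g *Λ (f *Λ h)                                                       ∎
  where open PermutationReasoning

*Λ-congˡ : ∀ f {g h} → g ↭ h → f *Λ g ↭ f *Λ h
*Λ-congˡ []      g↭h = ↭-refl
*Λ-congˡ (x ∷ f) g↭h = ++⁺ (map⁺ (x ⊗_) g↭h) (*Λ-congˡ f g↭h)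

·Λ-*Λ-assoc : ∀ c f g → (c ·Λ f) *Λ g ≡ c ·Λ (f *Λ g)
·Λ-*Λ-assoc c []      g = refl
·Λ-*Λ-assoc c (x ∷ f) g = begin
  map ((c ℚ.* proj₁ x , proj₂ x) ⊗_) g ++ (c ·Λ f) *Λ g  ≡⟨ cong₂ _++_ scale-leading (·Λ-*Λ-assoc c f g) ⟩
  c ·Λ map (x ⊗_) g ++ c ·Λ (f *Λ g)                     ≡⟨ map-++ _ (map (x ⊗_) g) (f *Λ g) ⟨
  c ·Λ (map (x ⊗_) g ++ f *Λ g)                          ∎
  where
  open ≡-Reasoning
  scale-leading : map ((c ℚ.* proj₁ x , proj₂ x) ⊗_) g ≡ c ·Λ map (x ⊗_) g
  scale-leading = trans (map-cong (λ y → cong (_, _) (ℚ.*-assoc c (proj₁ x) (proj₁ y))) g) (map-∘ g)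

concatMap-*Λ : ∀ {A : Set} (F : A → Λ) xs g → concatMap (λ x → F x *Λ g) xs ≡ concatMap F xs *Λ g
concatMap-*Λ F []       g = refl
concatMap-*Λ F (x ∷ xs) g =
  trans (cong (F x *Λ g ++_) (concatMap-*Λ F xs g)) (sym (concatMap-++ _ (F x) (concatMap F xs)))

coeffTerm : Term → Partition → ℚ
coeffTerm (c , ν) μ with ≡-dec ℕ._≟_ ν μ
... | yes _ = c
... | no _  = 0ℚ

coeff-≡-sum : ∀ f μ → coeff f μ ≡ foldr ℚ._+_ 0ℚ (map (λ x → coeffTerm x μ) f)
coeff-≡-sum []            μ = refl
coeff-≡-sum ((c , ν) ∷ f) μ with ≡-dec ℕ._≟_ ν μ
... | yes _ = cong (c ℚ.+_) (coeff-≡-sum f μ)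
... | no _  = trans (coeff-≡-sum f μ) (sym (ℚ.+-identityˡ _))

coeff-↭ : ∀ {f g} → f ↭ g → f ≈Λ g
coeff-↭ {f} {g} f↭g μ = begin
  coeff f μ                                      ≡⟨ coeff-≡-sum f μ ⟩
  foldr ℚ._+_ 0ℚ (map (λ x → coeffTerm x μ) f)  ≡⟨ foldr-commMonoid ℚ.+-0-isCommutativeMonoid (↭⇒↭ₛ (map⁺ _ f↭g)) ⟩
  foldr ℚ._+_ 0ℚ (map (λ x → coeffTerm x μ) g)  ≡⟨ coeff-≡-sum g μ ⟨
  coeff g μ                                      ∎
  where open ≡-Reasoning

ψ-concatMap-*t : ∀ {A : Set} (G : A → Λt) xs g → ψ (concatMap G xs *t g) ≡ concatMap (λ x → ψ (G x *t g)) xs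
ψ-concatMap-*t G []       g = refl
ψ-concatMap-*t G (x ∷ xs) g = begin
  ψ ((G x ++ concatMap G xs) *t g)         ≡⟨ cong ψ (concatMap-++ _ (G x) (concatMap G xs)) ⟩
  ψ (G x *t g ++ concatMap G xs *t g)      ≡⟨ map-++ _ (G x *t g) (concatMap G xs *t g) ⟩
  ψ (G x *t g) ++ ψ (concatMap G xs *t g)  ≡⟨ cong (ψ (G x *t g) ++_) (ψ-concatMap-*t G xs g) ⟩
  ψ (G x *t g) ++ concatMap (λ x → ψ (G x *t g)) xs  ∎
  where open ≡-Reasoning

ψ-tpow-*t : ∀ m f g → ψ (tpow m f *t g) ≡ (sgn m ·Λ (p (suc m) *Λ f)) *Λ g
ψ-tpow-*t m []            g = refl
ψ-tpow-*t m ((c , μ) ∷ f) g =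
  trans (map-++ _ (map _ g) (tpow m f *t g))
        (cong₂ _++_ (trans (sym (map-∘ g)) (map-cong leading g)) (ψ-tpow-*t m f g))
  where
  leading : ∀ y → (sgn m ℚ.* c ℚ.* proj₁ y , insertPart (suc m) (μ ∪ proj₂ y))
                   ≡ (sgn m ℚ.* (1ℚ ℚ.* c) , insertPart (suc m) μ) ⊗ y
  leading (d , ν) = cong₂ _,_ (cong (λ r → sgn m ℚ.* r ℚ.* d) (sym (ℚ.*-identityˡ c)))
                              (sym (insertPart-∪ (suc m) μ ν))

[1+k]*[1/1+k]≡1 : ∀ k → (+ suc k / 1) ℚ.* (+ 1 / suc k) ≡ 1ℚ
[1+k]*[1/1+k]≡1 k = begin
  (+ suc k / 1) ℚ.* (+ 1 / suc k)  ≡⟨ cong₂ ℚ._*_ (ℚ.normalize-coprime k+1/1-coprime) (ℚ.normalize-coprime (1-coprimeTo (suc k))) ⟩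
  k+1 ℚ.* ℚ.1/ k+1                 ≡⟨ ℚ.*-inverseʳ k+1 ⟩
  1ℚ                               ∎
  where
  open ≡-Reasoning
  k+1/1-coprime : Coprime (suc k) 1
  k+1/1-coprime = Coprimality.sym (1-coprimeTo (suc k))
  k+1 : ℚ
  k+1 = mkℚ (+ suc k) 0 k+1/1-coprime

·Λ-cancel : ∀ k f → (+ suc k / 1) ·Λ ((+ 1 / suc k) ·Λ f) ≡ f
·Λ-cancel k f = begin
  (+ suc k / 1) ·Λ ((+ 1 / suc k) ·Λ f)  ≡⟨ map-∘ f ⟨
  map _ f                                 ≡⟨ map-cong cancel f ⟩
  map id f                                ≡⟨ map-id f ⟩
  f                                       ∎
  where
  open ≡-Reasoning
  cancel : ∀ ((c , μ) : Term) → ((+ suc k / 1) ℚ.* ((+ 1 / suc k) ℚ.* c) , μ) ≡ (c , μ)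
  cancel (c , μ) = cong (_, μ) (begin
    (+ suc k / 1) ℚ.* ((+ 1 / suc k) ℚ.* c)  ≡⟨ ℚ.*-assoc (+ suc k / 1) (+ 1 / suc k) c ⟨
    (+ suc k / 1) ℚ.* (+ 1 / suc k) ℚ.* c    ≡⟨ cong (ℚ._* c) ([1+k]*[1/1+k]≡1 k) ⟩
    1ℚ ℚ.* c                                 ≡⟨ ℚ.*-identityˡ c ⟩
    c                                        ∎)

eDown≡applyUpTo : ∀ k → eDown k ≡ applyUpTo (λ j → e (k ∸ j)) (suc k)
eDown≡applyUpTo zero    = refl
eDown≡applyUpTo (suc k) = cong (e (suc k) ∷_) (eDown≡applyUpTo k)

newtonSummand : ℕ × Λ → Λ
newtonSummand (j , eⱼ) = sgn j ·Λ (p (suc j) *Λ eⱼ)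

newton : ∀ k → (+ suc k / 1) ·Λ e (suc k) ≡ concatMap (λ j → newtonSummand (j , e (k ∸ j))) (upTo (suc k))
newton k = begin
  (+ suc k / 1) ·Λ e (suc k)                                             ≡⟨ ·Λ-cancel k _ ⟩
  concatMap newtonSummand (zip (upTo (suc k)) (eDown k))                 ≡⟨ cong (concatMap newtonSummand ∘ zip (upTo (suc k))) (eDown≡applyUpTo k) ⟩
  concatMap newtonSummand (zip (upTo (suc k)) (applyUpTo e[k∸_] (suc k)))  ≡⟨ cong (concatMap newtonSummand) (zip-applyUpTo id e[k∸_] (suc k)) ⟩
  concatMap newtonSummand (applyUpTo (λ j → j , e[k∸ j ]) (suc k))       ≡⟨ cong concat (map-applyUpTo (λ j → j , e[k∸ j ]) newtonSummand (suc k)) ⟩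
  concat (applyUpTo (λ j → newtonSummand (j , e[k∸ j ])) (suc k))        ≡⟨ cong concat (map-applyUpTo id (λ j → newtonSummand (j , e[k∸ j ])) (suc k)) ⟨
  concatMap (λ j → newtonSummand (j , e[k∸ j ])) (upTo (suc k))          ∎
  where
  open ≡-Reasoning
  e[k∸_] : ℕ → Λ
  e[k∸ j ] = e (k ∸ j)

ψ-eii-*t : ∀ k g → ψ (eii (suc k) *t g) ≡ ((+ suc k / 1) ·Λ e (suc k)) *Λ g
ψ-eii-*t k g = begin
  ψ (eii (suc k) *t g)                                             ≡⟨ ψ-concatMap-*t (λ j → tpow j (e (k ∸ j))) (upTo (suc k)) g ⟩
  concatMap (λ j → ψ (tpow j (e (k ∸ j)) *t g)) (upTo (suc k))     ≡⟨ concatMap-cong (λ j → ψ-tpow-*t j (e (k ∸ j)) g) (upTo (suc k)) ⟩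
  concatMap (λ j → newtonSummand (j , e (k ∸ j)) *Λ g) (upTo (suc k))  ≡⟨ concatMap-*Λ (λ j → newtonSummand (j , e (k ∸ j))) (upTo (suc k)) g ⟩
  concatMap (λ j → newtonSummand (j , e (k ∸ j))) (upTo (suc k)) *Λ g  ≡⟨ cong (_*Λ g) (newton k) ⟨
  ((+ suc k / 1) ·Λ e (suc k)) *Λ g                                ∎
  where open ≡-Reasoning

e-*Λ-eP-─ : ∀ (λ′ : List ℕ) {i} (i∈λ : i ∈ λ′) → e i *Λ eP (λ′ ─ i∈λ) ↭ eP λ′
e-*Λ-eP-─ (j ∷ λ′)     (here refl)  = ↭-refl
e-*Λ-eP-─ (j ∷ λ′) {i} (there i∈λ) =
  ↭-trans (*Λ-lcomm (e i) (e j) (eP (λ′ ─ i∈λ))) (*Λ-congˡ (e j) (e-*Λ-eP-─ λ′ i∈λ))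

lemma4p5 : (λ′ : List ℕ) → All (0 <_) λ′ → (i : ℕ) → (i∈λ : i ∈ λ′) →
    ψ (eii i *t eP (λ′ ─ i∈λ)) ≈Λ ((+ i / 1) ·Λ eP λ′)
lemma4p5 λ′ pos zero    i∈λ with () ← lookup pos i∈λ
lemma4p5 λ′ pos (suc k) i∈λ = coeff-↭ (begin
  ψ (eii (suc k) *t eP (λ′ ─ i∈λ))               ≡⟨ ψ-eii-*t k (eP (λ′ ─ i∈λ)) ⟩
  ((+ suc k / 1) ·Λ e (suc k)) *Λ eP (λ′ ─ i∈λ)  ≡⟨ ·Λ-*Λ-assoc (+ suc k / 1) (e (suc k)) (eP (λ′ ─ i∈λ)) ⟩
  (+ suc k / 1) ·Λ (e (suc k) *Λ eP (λ′ ─ i∈λ))  ↭⟨ map⁺ _ (e-*Λ-eP-─ λ′ i∈λ) ⟩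
  (+ suc k / 1) ·Λ eP λ′                          ∎)
  where open PermutationReasoning
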